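{- We have $$\{w\in\mathfrak{W}_p^{\ddagger}:|(w^{ -1}\Delta)\setminus\Phi_p|=1\}=\{w\in W_p:\Delta_p\subset w^{ -1}(\Delta_p\cup\Phi_p^-)\}.$$
   Context: Let $\Phi$ be a reduced irreducible root system of rank $r$ in a real inner product space, with fundamental system $\Delta=\{\alpha_1,\dots,\alpha_r\}$, positive roots $\Phi^+$, $\Phi^-=-\Phi^+$, coroots $\alpha^\vee=2\alpha/\langle\alpha,\alpha\rangle$, fundamental weights $\lambda_i$ with $\langle\lambda_i,\alpha_j^\vee\rangle=\delta_{ij}$, Weyl group $W$. Fix $1\le p\le r$; $\Delta_p=\Delta\setminus\{\alpha_p\}$, $\Phi_p=\{\alpha\in\Phi:\langle\lambda_p,\alpha^\vee\rangle=0\}$, $\Phi_p^\pm=\Phi_p\cap\Phi^\pm$, $W_p$ the subgroup of $W$ generated by the simple reflections in $\Delta_p$, $\mathfrak{W}_p=\{w\in W:\Delta_p\subset w^{ -1}(\Delta\cup\Phi^-)\}$, $l_p(w)=|(\Phi^+\setminus\Phi_p^+)\cap w^{ -1}\Phi^-|$, and $\mathfrak{W}_p^{\ddagger}=\{w\in\mathfrak{W}_p:l_p(w)=0\}$. -}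

module Defs where

open import Data.Nat using (ℕ)
open import Data.Integer using (ℤ; +_; _-_; _*_; _+_; _<_; _≤_; 0ℤ)
open import Data.Fin using (Fin; _≟_)
open import Data.Vec using (Vec; tabulate; lookup; replicate; foldr)
open import Data.List using (List; []; _∷_)
import Data.List.Membership.Propositional
import Data.Nat
open import Data.Product using (Σ; ∃; ∃-syntax; _×_; _,_)
open import Data.Sum using (_⊎_)
open import Relation.Nullary using (¬_; yes; no)
open import Relation.Binary.PropositionalEquality using (_≡_; _≢_)

∑ : {r : ℕ} → (Fin r → ℤ) → ℤ
∑ f = foldr _ _+_ 0ℤ (tabulate f)

-- Cartan matrices.  Convention: A i j = ⟨α_i^∨ , α_j⟩  (so A i i = 2).

Matrix : ℕ → Set
Matrix r = Fin r → Fin r → ℤ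

IsGCM : {r : ℕ} → Matrix r → Set
IsGCM {r} A = ((i : Fin r) → A i i ≡ + 2)
            × ((i j : Fin r) → i ≢ j → A i j ≤ 0ℤ)

-- Symmetrisable with symmetriser d (d i = ⟨α_i,α_i⟩/2, scaled to
-- positive integers) such that B i j = d i * A i j  (= ⟨α_i,α_j⟩) is
-- symmetric and positive definite.
-- (Positive definiteness of a rational quadratic form tested on integer
-- vectors: equivalent to testing on rational / real vectors.)
PosDefSymmetrisable : {r : ℕ} → Matrix r → Set
PosDefSymmetrisable {r} A =
  Σ (Fin r → ℕ) λ d →
      ((i : Fin r) → 0 Data.Nat.< d i)
    × ((i j : Fin r) → (+ d i) * A i j ≡ (+ d j) * A j i)
    × ((x : Vec ℤ r) → x ≢ replicate r 0ℤ →
         0ℤ < ∑ (λ i → ∑ (λ j → lookup x i * (+ d i) * A i j * lookup x j)))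

data Reach {r : ℕ} (A : Matrix r) (i : Fin r) : Fin r → Set where
  here : Reach A i i
  step : ∀ {j k} → Reach A i j → A j k ≢ 0ℤ → Reach A i k

Irreducible : {r : ℕ} → Matrix r → Set
Irreducible {r} A = (i j : Fin r) → Reach A i j

IsIrredFiniteCartan : {r : ℕ} → Matrix r → Set
IsIrredFiniteCartan A = IsGCM A × PosDefSymmetrisable A × Irreducible A

-- The root lattice: β = Σ β_k α_k, coordinates w.r.t. the fundamental
-- system Δ.

Lat : ℕ → Set
Lat r = Vec ℤ r

α : {r : ℕ} → Fin r → Lat r
α i = tabulate λ k → δ k
  where
  δ : _ → ℤ
  δ k with k ≟ i
  ... | yes _ = + 1
  ... | no  _ = 0ℤ

module _ {r : ℕ} (A : Matrix r) where

  pair : Fin r → Lat r → ℤ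
  pair i β = ∑ λ j → A i j * lookup β j

  s : Fin r → Lat r → Lat r
  s i β = tabulate λ k → c k
    where
    c : Fin r → ℤ
    c k with k ≟ i
    ... | yes _ = lookup β k - pair i β
    ... | no  _ = lookup β k

  -- Elements of W are represented by words in the simple reflections;
  -- the word i₁ ∷ … ∷ iₙ acts as s_{i₁} ∘ … ∘ s_{iₙ}.
  Word : Set
  Word = List (Fin r)

  act : Word → Lat r → Lat r
  act []      β = β
  act (i ∷ w) β = s i (act w β)

  -- equality in W: equality of the linear maps
  _≈W_ : Word → Word → Set
  w ≈W v = (β : Lat r) → act w β ≡ act v β

  -- roots: Φ = W Δ
  IsRoot : Lat r → Set
  IsRoot β = ∃[ w ] ∃[ i ] act w (α i) ≡ β

  NonNeg NonPos : Lat r → Set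
  NonNeg β = (k : Fin r) → 0ℤ ≤ lookup β k
  NonPos β = (k : Fin r) → lookup β k ≤ 0ℤ

  InΦ⁺ InΦ⁻ InΔ : Lat r → Set
  InΦ⁺ β = IsRoot β × NonNeg β
  InΦ⁻ β = IsRoot β × NonPos β
  InΔ  β = ∃[ i ] α i ≡ β

  module _ (p : Fin r) where

    InΔp : Lat r → Set
    InΔp β = ∃[ i ] i ≢ p × α i ≡ β

    -- Φ_p = {β ∈ Φ : ⟨λ_p, β^∨⟩ = 0} = roots whose α_p-coefficient is 0
    InΦp : Lat r → Set
    InΦp β = IsRoot β × lookup β p ≡ 0ℤ

    InΦp⁻ InΦp⁺ : Lat r → Set
    InΦp⁻ β = InΦp β × NonPos β
    InΦp⁺ β = InΦp β × NonNeg β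

    -- note: β ∈ w⁻¹ X  ⇔  w β ∈ X.

    InFrakWp : Word → Set
    InFrakWp w = (β : Lat r) → InΔp β → InΔ (act w β) ⊎ InΦ⁻ (act w β)

    -- l_p(w) = 0, i.e. (Φ⁺ ∖ Φ_p⁺) ∩ w⁻¹Φ⁻ is empty
    lp≡0 : Word → Set
    lp≡0 w = (β : Lat r) → InΦ⁺ β → ¬ InΦp⁺ β → ¬ InΦ⁻ (act w β)

    InFrakWp‡ : Word → Set
    InFrakWp‡ w = InFrakWp w × lp≡0 w

    InW⁻¹Δ∖Φp : Word → Lat r → Set
    InW⁻¹Δ∖Φp w β = InΔ (act w β) × ¬ InΦp β

    CardOne : Word → Set
    CardOne w = ∃[ β ] InW⁻¹Δ∖Φp w β
                  × ((γ : Lat r) → InW⁻¹Δ∖Φp w γ → γ ≡ β)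

    InWp : Word → Set
    InWp w = ∃[ v ] ((i : Fin r) → i Data.List.Membership.Propositional.∈ v → i ≢ p) × v ≈W w

    LHS RHS : Word → Set
    LHS w = InFrakWp‡ w × CardOne w
    RHS w = InWp w × ((β : Lat r) → InΔp β → InΔp (act w β) ⊎ InΦp⁻ (act w β))

-- Everything rests on the fact that every root β = wα_i is nonnegative or nonpositive in the
-- basis Δ.  The form ⟨x, y⟩ = Σ x_i d_i A_ij y_j is W-invariant and positive definite, ⟨β, β⟩ = 2d_i,
-- and d_i divides every d_k β_k; hence any nonzero vector y with that divisibility property has
-- ⟨y, y⟩ ≥ 2d_i.  Writing β = β⁺ − β⁻ with disjoint supports gives ⟨β⁺, β⁻⟩ ≤ 0, so if both parts
-- were nonzero then ⟨β, β⟩ ≥ 4d_i.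
--
-- For ⊇: an element of W_p fixes the α_p-coordinate, so l_p(w) = 0, and w⁻¹α_p is the unique
-- element of w⁻¹Δ outside Φ_p.  For ⊆ it suffices that l_p(w) = 0 forces w ∈ W_p, by induction on
-- the length of a word w = y s_j.  If wα_j < 0 then l_p(w) = 0 forces j ≠ p, and y = w s_j again
-- has l_p(y) = 0 because s_j permutes Φ⁺ ∖ Φ_p.  If wα_j > 0 then yα_j < 0, and the exchange
-- condition gives a shorter word for w.

module Submission where

open import Defs
open import Data.Empty using (⊥; ⊥-elim)
open import Data.Fin using (Fin; zero; suc; _≟_)
open import Data.Integer as ℤ
  using (ℤ; +_; -[1+_]; 0ℤ; -_; _+_; _-_; _*_; _≤_; _<_; +≤+; +<+; -≤+)
open import Data.Integer.Divisibility.Signed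
  using (_∣_; divides; ∣⇒∣ᵤ; ∣-refl; ∣m⇒∣-m; ∣m∣n⇒∣m+n; ∣m∣n⇒∣m-n; ∣n⇒∣m*n; ∣m⇒∣m*n; *-monoʳ-∣)
import Data.Integer.Properties as ℤP
open import Data.Integer.Tactic.RingSolver using (solve-∀)
open import Data.List using (List; []; _∷_; _++_; _∷ʳ_; reverse; length; initLast; _∷ʳ′_)
open import Data.List.Properties using (unfold-reverse; reverse-involutive; length-++)
open import Data.List.Relation.Unary.All as All using (All; []; _∷_)
import Data.List.Relation.Unary.All.Properties as AllP
open import Data.Nat as ℕ using (ℕ; zero; suc)
open import Data.Nat.Induction using (<-wellFounded)
import Data.Nat.Divisibility as ℕD
import Data.Nat.Properties as ℕP
open import Data.Product using (_×_; _,_; ∃-syntax)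
open import Data.Sum using (_⊎_; inj₁; inj₂; [_,_]′)
open import Data.Vec as Vec using (Vec; lookup; replicate)
open import Data.Vec.Functional using (map)
open import Data.Vec.Properties using (lookup∘tabulate; lookup-map; lookup-replicate; ≡-dec)
open import Data.Vec.Relation.Binary.Pointwise.Extensional using (ext; Pointwise-≡⇒≡)
open import Function.Base using (id; _∘_; _∋_)
open import Induction.WellFounded using (Acc; acc)
open import Relation.Binary.PropositionalEquality
open import Relation.Nullary using (¬_; yes; no)
open ≡-Reasoning

import Algebra.Properties.Semiring.Sum ℤP.+-*-semiring as Σ

i*j≡1⇒j≡1 : ∀ i {j} → 0ℤ ≤ j → i * j ≡ + 1 → j ≡ + 1
i*j≡1⇒j≡1 i {j} 0≤j ij≡1 = trans (sym (ℤP.0≤i⇒+∣i∣≡i 0≤j))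
  (cong +_ (ℕP.m*n≡1⇒n≡1 ℤ.∣ i ∣ ℤ.∣ j ∣ (trans (sym (ℤP.abs-* i j)) (cong ℤ.∣_∣ ij≡1))))

∣⇒≤ : ∀ {i j} → 0ℤ ≤ i → 0ℤ < j → i ∣ j → i ≤ j
∣⇒≤ {+ m} {+ suc n} _ _         i∣j = +≤+ (ℕD.∣⇒≤ (∣⇒∣ᵤ i∣j))
∣⇒≤ {+ m} {+ 0}     _ (+<+ ()) _

0≤i⇒j≤0⇒i*j≤0 : ∀ {i j} → 0ℤ ≤ i → j ≤ 0ℤ → i * j ≤ 0ℤ
0≤i⇒j≤0⇒i*j≤0 {i} 0≤i j≤0 =
  subst (i * _ ≤_) (ℤP.*-zeroʳ i) (ℤP.*-monoˡ-≤-nonNeg i {{ℤ.nonNegative 0≤i}} j≤0)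

0≤i⇒0≤j⇒0≤i*j : ∀ {i j} → 0ℤ ≤ i → 0ℤ ≤ j → 0ℤ ≤ i * j
0≤i⇒0≤j⇒0≤i*j {i} 0≤i 0≤j =
  subst (_≤ i * _) (ℤP.*-zeroʳ i) (ℤP.*-monoˡ-≤-nonNeg i {{ℤ.nonNegative 0≤i}} 0≤j)

i+j≤i⇒j≤0 : ∀ {i j} → i + j ≤ i → j ≤ 0ℤ
i+j≤i⇒j≤0 {i} {j} i+j≤i = subst₂ _≤_ (cancel i j) (ℤP.+-inverseˡ i) (ℤP.+-monoʳ-≤ (- i) i+j≤i)
  where
  cancel : ∀ i j → - i + (i + j) ≡ j
  cancel = solve-∀

_⁺ _⁻ : ℤ → ℤ
(+ n)    ⁺ = + n
-[1+ n ] ⁺ = 0ℤ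
(+ n)    ⁻ = 0ℤ
-[1+ n ] ⁻ = + suc n

⁺-nonneg : ∀ z → 0ℤ ≤ z ⁺
⁺-nonneg (+ n)    = +≤+ ℕ.z≤n
⁺-nonneg -[1+ n ] = +≤+ ℕ.z≤n

⁻-nonneg : ∀ z → 0ℤ ≤ z ⁻
⁻-nonneg (+ n)    = +≤+ ℕ.z≤n
⁻-nonneg -[1+ n ] = +≤+ ℕ.z≤n

⁺-⁻ : ∀ z → z ≡ z ⁺ - z ⁻
⁺-⁻ (+ n)    = sym (ℤP.+-identityʳ (+ n))
⁺-⁻ -[1+ n ] = refl

⁺*⁻ : ∀ z → z ⁺ * z ⁻ ≡ 0ℤ
⁺*⁻ (+ n)    = ℤP.*-zeroʳ (+ n)
⁺*⁻ -[1+ n ] = refl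

⁻≡0⇒0≤ : ∀ {z} → z ⁻ ≡ 0ℤ → 0ℤ ≤ z
⁻≡0⇒0≤ {+ n} _ = +≤+ ℕ.z≤n

⁺≡0⇒≤0 : ∀ {z} → z ⁺ ≡ 0ℤ → z ≤ 0ℤ
⁺≡0⇒≤0 {+ 0}    _ = ℤP.≤-refl
⁺≡0⇒≤0 { -[1+ n ]} _ = -≤+

∣*⇒∣*⁺ : ∀ {e} c z → e ∣ c * z → e ∣ c * z ⁺
∣*⇒∣*⁺ c (+ n)    e∣cz = e∣cz
∣*⇒∣*⁺ c -[1+ n ] _    = subst (_ ∣_) (sym (ℤP.*-zeroʳ c)) (divides 0ℤ refl)

∣*⇒∣*⁻ : ∀ {e} c z → e ∣ c * z → e ∣ c * z ⁻
∣*⇒∣*⁻ c (+ n)    _    = subst (_ ∣_) (sym (ℤP.*-zeroʳ c)) (divides 0ℤ refl)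
∣*⇒∣*⁻ c -[1+ n ] e∣cz = subst (_ ∣_) (ℤP.neg-distribʳ-* c -[1+ n ]) (∣m⇒∣-m e∣cz)

_⁺ᵛ _⁻ᵛ : ∀ {n} → Vec ℤ n → Vec ℤ n
x ⁺ᵛ = Vec.map _⁺ x
x ⁻ᵛ = Vec.map _⁻ x

lookup-⁺ᵛ-⁻ᵛ : ∀ {n} (x : Vec ℤ n) k → lookup x k ≡ lookup (x ⁺ᵛ) k - lookup (x ⁻ᵛ) k
lookup-⁺ᵛ-⁻ᵛ x k = trans (⁺-⁻ (lookup x k)) (sym (cong₂ _-_ (lookup-map k _⁺ x) (lookup-map k _⁻ x)))

map≡replicate⇒lookup : ∀ {a b} {A : Set a} {B : Set b} {n} {f : A → B} {z} (x : Vec A n) →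
                       Vec.map f x ≡ replicate n z → ∀ k → f (lookup x k) ≡ z
map≡replicate⇒lookup {f = f} {z} x fx≡z k =
  trans (sym (lookup-map k f x)) (trans (cong (λ v → lookup v k) fx≡z) (lookup-replicate k z))

length-∷ʳ : ∀ {a} {A : Set a} (xs : List A) x → length (xs ∷ʳ x) ≡ suc (length xs)
length-∷ʳ xs x = trans (length-++ xs) (ℕP.+-comm (length xs) 1)

lookup-ext : ∀ {n} {x y : Vec ℤ n} → (∀ k → lookup x k ≡ lookup y k) → x ≡ y
lookup-ext = Pointwise-≡⇒≡ ∘ ext

∑≡sum : ∀ {n} (f : Fin n → ℤ) → ∑ f ≡ Σ.sum f
∑≡sum {zero}  f = refl
∑≡sum {suc n} f = cong (_+_ (f zero)) (∑≡sum (λ i → f (suc i)))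

∑-cong : ∀ {n} {f g : Fin n → ℤ} → (∀ i → f i ≡ g i) → ∑ f ≡ ∑ g
∑-cong {f = f} {g} f≗g = trans (∑≡sum f) (trans (Σ.sum-cong-≗ f≗g) (sym (∑≡sum g)))

∑-zero : ∀ n → ∑ {n} (λ _ → 0ℤ) ≡ 0ℤ
∑-zero n = trans (∑≡sum {n} (λ _ → 0ℤ)) (Σ.sum-replicate-zero n)

∑-distrib-+ : ∀ {n} (f g : Fin n → ℤ) → ∑ (λ i → f i + g i) ≡ ∑ f + ∑ g
∑-distrib-+ f g = begin
  ∑ (λ i → f i + g i)      ≡⟨ ∑≡sum (λ i → f i + g i) ⟩
  Σ.sum (λ i → f i + g i)  ≡⟨ Σ.∑-distrib-+ f g ⟩
  Σ.sum f + Σ.sum g        ≡⟨ sym (cong₂ _+_ (∑≡sum f) (∑≡sum g)) ⟩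
  ∑ f + ∑ g                ∎

*-distribˡ-∑ : ∀ {n} c (f : Fin n → ℤ) → c * ∑ f ≡ ∑ (λ i → c * f i)
*-distribˡ-∑ c f = begin
  c * ∑ f               ≡⟨ cong (c *_) (∑≡sum f) ⟩
  c * Σ.sum f           ≡⟨ Σ.*-distribˡ-sum c f ⟩
  Σ.sum (map (c *_) f)  ≡⟨ sym (∑≡sum (map (c *_) f)) ⟩
  ∑ (λ i → c * f i)     ∎

∑-comm : ∀ {m n} (f : Fin m → Fin n → ℤ) → ∑ (λ i → ∑ (f i)) ≡ ∑ (λ j → ∑ (λ i → f i j))
∑-comm f = begin
  ∑ (λ i → ∑ (f i))                     ≡⟨ ∑-cong (λ i → ∑≡sum (f i)) ⟩
  ∑ (λ i → Σ.sum (f i))                 ≡⟨ ∑≡sum (λ i → Σ.sum (f i)) ⟩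
  Σ.sum (λ i → Σ.sum (f i))             ≡⟨ Σ.∑-comm f ⟩
  Σ.sum (λ j → Σ.sum (λ i → f i j))     ≡⟨ sym (∑≡sum (λ j → Σ.sum (λ i → f i j))) ⟩
  ∑ (λ j → Σ.sum (λ i → f i j))         ≡⟨ ∑-cong (λ j → sym (∑≡sum (λ i → f i j))) ⟩
  ∑ (λ j → ∑ (λ i → f i j))             ∎

*-distribʳ-∑ : ∀ {n} c (f : Fin n → ℤ) → ∑ f * c ≡ ∑ (λ i → f i * c)
*-distribʳ-∑ c f = trans (ℤP.*-comm (∑ f) c)
  (trans (*-distribˡ-∑ c f) (∑-cong (λ i → ℤP.*-comm c (f i))))

∑-neg : ∀ {n} (f : Fin n → ℤ) → ∑ (λ i → - f i) ≡ - ∑ f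
∑-neg {zero}  f = refl
∑-neg {suc n} f = trans (cong (_+_ (- f zero)) (∑-neg (λ i → f (suc i))))
  (sym (ℤP.neg-distrib-+ (f zero) _))

∑-distrib-- : ∀ {n} (f g : Fin n → ℤ) → ∑ (λ i → f i - g i) ≡ ∑ f - ∑ g
∑-distrib-- f g = trans (∑-distrib-+ f (λ i → - g i)) (cong (_+_ (∑ f)) (∑-neg g))

∑-nonpos : ∀ {n} (f : Fin n → ℤ) → (∀ i → f i ≤ 0ℤ) → ∑ f ≤ 0ℤ
∑-nonpos {zero}  f f≤0 = ℤP.≤-refl
∑-nonpos {suc n} f f≤0 = ℤP.+-mono-≤ (f≤0 zero) (∑-nonpos _ (λ i → f≤0 (suc i)))

∣-∑ : ∀ {n} {e} (f : Fin n → ℤ) → (∀ i → e ∣ f i) → e ∣ ∑ f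
∣-∑ {zero}  f e∣f = divides 0ℤ refl
∣-∑ {suc n} f e∣f = ∣m∣n⇒∣m+n (e∣f zero) (∣-∑ _ (λ i → e∣f (suc i)))

∣-∑∑-symmetric : ∀ {n} {e} (T : Fin n → Fin n → ℤ) → (∀ i j → T i j ≡ T j i) →
                 (∀ i → + 2 * e ∣ T i i) → (∀ i j → e ∣ T i j) →
                 + 2 * e ∣ ∑ (λ i → ∑ (T i))
∣-∑∑-symmetric {zero}  T sym-T 2e∣Tii e∣T = divides 0ℤ refl
∣-∑∑-symmetric {suc n} {e} T sym-T 2e∣Tii e∣T = subst (+ 2 * e ∣_) (sym split)
  (∣m∣n⇒∣m+n (∣m∣n⇒∣m+n (2e∣Tii zero) (*-monoʳ-∣ (+ 2) (∣-∑ _ (λ j → e∣T zero (suc j)))))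
             (∣-∑∑-symmetric (λ i j → T (suc i) (suc j)) (λ i j → sym-T (suc i) (suc j))
                             (λ i → 2e∣Tii (suc i)) (λ i j → e∣T (suc i) (suc j))))
  where
  S R : ℤ
  S = ∑ (λ j → T zero (suc j))
  R = ∑ (λ i → ∑ (λ j → T (suc i) (suc j)))
  split : ∑ (λ i → ∑ (T i)) ≡ T zero zero + + 2 * S + R
  split = begin
    T zero zero + S + ∑ (λ i → T (suc i) zero + ∑ (λ j → T (suc i) (suc j)))
      ≡⟨ cong (_+_ (T zero zero + S)) (∑-distrib-+ (λ i → T (suc i) zero) _) ⟩
    T zero zero + S + (∑ (λ i → T (suc i) zero) + R)
      ≡⟨ cong (λ S′ → T zero zero + S + (S′ + R)) (∑-cong (λ i → sym-T (suc i) zero)) ⟩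
    T zero zero + S + (S + R)
      ≡⟨ regroup (T zero zero) S R ⟩
    T zero zero + + 2 * S + R ∎
    where
    regroup : ∀ a b c → a + b + (b + c) ≡ a + + 2 * b + c
    regroup = solve-∀

δ : ∀ {n} → Fin n → Fin n → ℤ
δ zero    zero    = + 1
δ zero    (suc _) = 0ℤ
δ (suc _) zero    = 0ℤ
δ (suc i) (suc j) = δ i j

δ-diag : ∀ {n} (i : Fin n) → δ i i ≡ + 1
δ-diag zero    = refl
δ-diag (suc i) = δ-diag i

δ-offdiag : ∀ {n} {i j : Fin n} → i ≢ j → δ i j ≡ 0ℤ
δ-offdiag {i = zero}  {zero}  i≢j = ⊥-elim (i≢j refl)
δ-offdiag {i = zero}  {suc j} i≢j = refl
δ-offdiag {i = suc i} {zero}  i≢j = refl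
δ-offdiag {i = suc i} {suc j} i≢j = δ-offdiag (i≢j ∘ cong suc)

δ-sym : ∀ {n} (i j : Fin n) → δ i j ≡ δ j i
δ-sym zero    zero    = refl
δ-sym zero    (suc j) = refl
δ-sym (suc i) zero    = refl
δ-sym (suc i) (suc j) = δ-sym i j

δ-nonneg : ∀ {n} (i j : Fin n) → 0ℤ ≤ δ i j
δ-nonneg zero    zero    = +≤+ ℕ.z≤n
δ-nonneg zero    (suc j) = +≤+ ℕ.z≤n
δ-nonneg (suc i) zero    = +≤+ ℕ.z≤n
δ-nonneg (suc i) (suc j) = δ-nonneg i j

∑-δˡ : ∀ {n} (k : Fin n) (g : Fin n → ℤ) → ∑ (λ j → δ k j * g j) ≡ g k
∑-δˡ {suc n} zero g = begin
  + 1 * g zero + ∑ (λ j → 0ℤ * g (suc j))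
    ≡⟨ cong₂ _+_ (ℤP.*-identityˡ (g zero)) (∑-cong (λ j → ℤP.*-zeroˡ (g (suc j)))) ⟩
  g zero + ∑ {n} (λ _ → 0ℤ)
    ≡⟨ cong (_+_ (g zero)) (∑-zero n) ⟩
  g zero + 0ℤ
    ≡⟨ ℤP.+-identityʳ (g zero) ⟩
  g zero ∎
∑-δˡ {suc n} (suc k) g = trans (ℤP.+-identityˡ _) (∑-δˡ k (λ j → g (suc j)))

∑-δʳ : ∀ {n} (k : Fin n) (g : Fin n → ℤ) → ∑ (λ j → g j * δ k j) ≡ g k
∑-δʳ k g = trans (∑-cong (λ j → ℤP.*-comm (g j) (δ k j))) (∑-δˡ k g)

-- Abstracting k ≟ i also in the type of lookup∘tabulate lets the entry defined in Defs reduce.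
lookup-α : ∀ {n} (i k : Fin n) → lookup (α i) k ≡ δ i k
lookup-α i k with k ≟ i | (lookup (α i) k ≡ _) ∋ lookup∘tabulate _ k
... | yes refl | α-k = trans α-k (sym (δ-diag k))
... | no k≢i   | α-k = trans α-k (sym (δ-offdiag (k≢i ∘ sym)))

lookup-α-diag : ∀ {n} (i : Fin n) → lookup (α i) i ≡ + 1
lookup-α-diag i = trans (lookup-α i i) (δ-diag i)

lookup-α-diag≢0 : ∀ {n} (i : Fin n) → lookup (α i) i ≢ 0ℤ
lookup-α-diag≢0 i αᵢᵢ≡0 with trans (sym (lookup-α-diag i)) αᵢᵢ≡0
... | ()

lookup-α-offdiag : ∀ {n} {i k : Fin n} → i ≢ k → lookup (α i) k ≡ 0ℤ
lookup-α-offdiag {i = i} {k} i≢k = trans (lookup-α i k) (δ-offdiag i≢k)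

α-nonneg : ∀ {n} (i k : Fin n) → 0ℤ ≤ lookup (α i) k
α-nonneg i k = subst (0ℤ ≤_) (sym (lookup-α i k)) (δ-nonneg i k)

module _ {r : ℕ} (A : Matrix r) where

  lookup-s : ∀ i β k → lookup (s A i β) k ≡ lookup β k - pair A i β * δ i k
  lookup-s i β k with k ≟ i | (lookup (s A i β) k ≡ _) ∋ lookup∘tabulate _ k
  ... | yes refl | s-k = begin
    lookup (s A k β) k               ≡⟨ s-k ⟩
    lookup β k - pair A k β          ≡⟨ cong (λ c → lookup β k - c) (sym (ℤP.*-identityʳ _)) ⟩
    lookup β k - pair A k β * + 1    ≡⟨ cong (λ c → lookup β k - pair A k β * c) (sym (δ-diag k)) ⟩
    lookup β k - pair A k β * δ k k  ∎
  ... | no k≢i   | s-k = begin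
    lookup (s A i β) k
      ≡⟨ s-k ⟩
    lookup β k
      ≡⟨ sym (ℤP.+-identityʳ _) ⟩
    lookup β k - 0ℤ
      ≡⟨ cong (λ c → lookup β k - c) (sym (ℤP.*-zeroʳ (pair A i β))) ⟩
    lookup β k - pair A i β * 0ℤ
      ≡⟨ cong (λ c → lookup β k - pair A i β * c) (sym (δ-offdiag (k≢i ∘ sym))) ⟩
    lookup β k - pair A i β * δ i k ∎

  lookup-s-≢ : ∀ {i k} β → i ≢ k → lookup (s A i β) k ≡ lookup β k
  lookup-s-≢ {i} {k} β i≢k = begin
    lookup (s A i β) k               ≡⟨ lookup-s i β k ⟩
    lookup β k - pair A i β * δ i k  ≡⟨ cong (λ c → lookup β k - pair A i β * c) (δ-offdiag i≢k) ⟩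
    lookup β k - pair A i β * 0ℤ     ≡⟨ cong (λ c → lookup β k - c) (ℤP.*-zeroʳ (pair A i β)) ⟩
    lookup β k - 0ℤ                  ≡⟨ ℤP.+-identityʳ _ ⟩
    lookup β k                       ∎

  pair-α : ∀ i j → pair A i (α j) ≡ A i j
  pair-α i j = trans (∑-cong (λ l → cong (A i l *_) (lookup-α j l))) (∑-δʳ j (A i))

  pair-s : ∀ j i x → pair A j (s A i x) ≡ pair A j x - pair A i x * A j i
  pair-s j i x = begin
    ∑ (λ l → A j l * lookup (s A i x) l)
      ≡⟨ ∑-cong (λ l → cong (A j l *_) (lookup-s i x l)) ⟩
    ∑ (λ l → A j l * (lookup x l - c * δ i l))
      ≡⟨ ∑-cong (λ l → expand (A j l) (lookup x l) c (δ i l)) ⟩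
    ∑ (λ l → A j l * lookup x l - c * (A j l * δ i l))
      ≡⟨ ∑-distrib-- {r} _ _ ⟩
    pair A j x - ∑ (λ l → c * (A j l * δ i l))
      ≡⟨ cong (_-_ (pair A j x)) (sym (*-distribˡ-∑ {r} c _)) ⟩
    pair A j x - c * ∑ (λ l → A j l * δ i l)
      ≡⟨ cong (λ t → pair A j x - c * t) (∑-δʳ i (A j)) ⟩
    pair A j x - c * A j i ∎
    where
    c = pair A i x
    expand : ∀ a y c e → a * (y - c * e) ≡ a * y - c * (a * e)
    expand = solve-∀

  act-++ : ∀ u v x → act A (u ++ v) x ≡ act A u (act A v x)
  act-++ []      v x = refl
  act-++ (i ∷ u) v x = cong (s A i) (act-++ u v x)

  act-linear : ∀ u x k → lookup (act A u x) k ≡ ∑ (λ m → lookup (act A u (α m)) k * lookup x m)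
  act-linear [] x k =
    sym (trans (∑-cong (λ m → cong (_* lookup x m) (trans (lookup-α m k) (δ-sym m k))))
               (∑-δˡ k (lookup x)))
  act-linear (i ∷ u) x k = begin
    lookup (s A i y) k
      ≡⟨ lookup-s i y k ⟩
    lookup y k - pair A i y * δ i k
      ≡⟨ cong₂ (λ a c → a - c * δ i k) (act-linear u x k) pair-y ⟩
    ∑ (λ m → U k m * xₘ m) - ∑ (λ m → b m * xₘ m) * δ i k
      ≡⟨ cong (_-_ (∑ (λ m → U k m * xₘ m))) (*-distribʳ-∑ {r} (δ i k) _) ⟩
    ∑ (λ m → U k m * xₘ m) - ∑ (λ m → b m * xₘ m * δ i k)
      ≡⟨ sym (∑-distrib-- {r} _ _) ⟩
    ∑ (λ m → U k m * xₘ m - b m * xₘ m * δ i k)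
      ≡⟨ ∑-cong (λ m → factor (U k m) (b m) (xₘ m) (δ i k)) ⟩
    ∑ (λ m → (U k m - b m * δ i k) * xₘ m)
      ≡⟨ ∑-cong (λ m → cong (_* xₘ m) (sym (lookup-s i (act A u (α m)) k))) ⟩
    ∑ (λ m → lookup (s A i (act A u (α m))) k * xₘ m) ∎
    where
    y = act A u x
    xₘ : Fin r → ℤ
    xₘ = lookup x
    U : Fin r → Fin r → ℤ
    U l m = lookup (act A u (α m)) l
    b : Fin r → ℤ
    b m = pair A i (act A u (α m))
    factor : ∀ a c z e → a * z - c * z * e ≡ (a - c * e) * z
    factor = solve-∀
    pair-y : pair A i y ≡ ∑ (λ m → b m * xₘ m)
    pair-y = begin
      ∑ (λ l → A i l * lookup y l)
        ≡⟨ ∑-cong (λ l → cong (A i l *_) (act-linear u x l)) ⟩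
      ∑ (λ l → A i l * ∑ (λ m → U l m * xₘ m))
        ≡⟨ ∑-cong (λ l → *-distribˡ-∑ {r} (A i l) _) ⟩
      ∑ (λ l → ∑ (λ m → A i l * (U l m * xₘ m)))
        ≡⟨ ∑-comm {r} {r} _ ⟩
      ∑ (λ m → ∑ (λ l → A i l * (U l m * xₘ m)))
        ≡⟨ ∑-cong {r} (λ m → ∑-cong {r} (λ l → sym (ℤP.*-assoc (A i l) _ _))) ⟩
      ∑ (λ m → ∑ (λ l → A i l * U l m * xₘ m))
        ≡⟨ ∑-cong (λ m → sym (*-distribʳ-∑ {r} (xₘ m) _)) ⟩
      ∑ (λ m → b m * xₘ m) ∎

  act-s : ∀ u j x k →
          lookup (act A u (s A j x)) k ≡ lookup (act A u x) k - pair A j x * lookup (act A u (α j)) k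
  act-s u j x k = begin
    lookup (act A u (s A j x)) k
      ≡⟨ act-linear u (s A j x) k ⟩
    ∑ (λ m → U m * lookup (s A j x) m)
      ≡⟨ ∑-cong (λ m → cong (U m *_) (lookup-s j x m)) ⟩
    ∑ (λ m → U m * (lookup x m - c * δ j m))
      ≡⟨ ∑-cong (λ m → expand (U m) (lookup x m) c (δ j m)) ⟩
    ∑ (λ m → U m * lookup x m - c * (U m * δ j m))
      ≡⟨ ∑-distrib-- {r} _ _ ⟩
    ∑ (λ m → U m * lookup x m) - ∑ (λ m → c * (U m * δ j m))
      ≡⟨ cong₂ _-_ (sym (act-linear u x k)) (sym (*-distribˡ-∑ {r} c _)) ⟩
    lookup (act A u x) k - c * ∑ (λ m → U m * δ j m)
      ≡⟨ cong (λ t → lookup (act A u x) k - c * t) (∑-δʳ j U) ⟩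
    lookup (act A u x) k - c * U j ∎
    where
    c = pair A j x
    U : Fin r → ℤ
    U m = lookup (act A u (α m)) k
    expand : ∀ a y c e → a * (y - c * e) ≡ a * y - c * (a * e)
    expand = solve-∀

  act-lookup-avoiding : ∀ {k} v x → All (_≢ k) v → lookup (act A v x) k ≡ lookup x k
  act-lookup-avoiding []      x []               = refl
  act-lookup-avoiding (i ∷ v) x (i≢k ∷ v-avoids) =
    trans (lookup-s-≢ (act A v x) i≢k) (act-lookup-avoiding v x v-avoids)

  α-positive : ∀ i → InΦ⁺ A (α i)
  α-positive i = ([] , i , refl) , α-nonneg i

  lp≡0-resp-≈W : ∀ {p} v w → _≈W_ A v w → lp≡0 A p w → lp≡0 A p v
  lp≡0-resp-≈W v w v≈w lp-w β β⁺ β∉Φₚ wβ⁻ = lp-w β β⁺ β∉Φₚ (subst (InΦ⁻ A) (v≈w β) wβ⁻)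

  lp≡0⇒≢p : ∀ {p} w j → lp≡0 A p w → NonPos A (act A w (α j)) → j ≢ p
  lp≡0⇒≢p w j lp-w wαⱼ≤0 refl = lp-w (α j) (α-positive j) αⱼ∉Φₚ ((w , j , refl) , wαⱼ≤0)
    where
    αⱼ∉Φₚ : ¬ InΦp⁺ A j (α j)
    αⱼ∉Φₚ ((_ , αⱼⱼ≡0) , _) = lookup-α-diag≢0 j αⱼⱼ≡0

  InWₚ : Fin r → Word A → Set
  InWₚ p w = ∃[ v ] All (_≢ p) v × _≈W_ A v w

  InWₚ-resp-≈W : ∀ {p} v w → _≈W_ A v w → InWₚ p v → InWₚ p w
  InWₚ-resp-≈W v w v≈w (u , u-avoids , u≈v) = u , u-avoids , λ β → trans (u≈v β) (v≈w β)

  InWₚ-∷ʳ : ∀ {p} w j → j ≢ p → InWₚ p w → InWₚ p (w ∷ʳ j)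
  InWₚ-∷ʳ w j j≢p (v , v-avoids , v≈w) = v ∷ʳ j , AllP.∷ʳ⁺ v-avoids j≢p , λ β → begin
    act A (v ∷ʳ j) β   ≡⟨ act-++ v (j ∷ []) β ⟩
    act A v (s A j β)  ≡⟨ v≈w (s A j β) ⟩
    act A w (s A j β)  ≡⟨ sym (act-++ w (j ∷ []) β) ⟩
    act A (w ∷ʳ j) β   ∎

  InWₚ⇒lookupₚ : ∀ {p} w → InWₚ p w → ∀ x → lookup (act A w x) p ≡ lookup x p
  InWₚ⇒lookupₚ {p} w (v , v-avoids , v≈w) x =
    trans (cong (λ y → lookup y p) (sym (v≈w x))) (act-lookup-avoiding v x v-avoids)

  InWp⇒InWₚ : ∀ {p} w → InWp A p w → InWₚ p w
  InWp⇒InWₚ w (v , v-avoids , v≈w) = v , All.tabulate (λ {i} → v-avoids i) , v≈w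

  InWₚ⇒InWp : ∀ {p} w → InWₚ p w → InWp A p w
  InWₚ⇒InWp w (v , v-avoids , v≈w) = v , (λ _ → All.lookup v-avoids) , v≈w

  InWₚ⇒lp≡0 : ∀ {p} w → InWₚ p w → lp≡0 A p w
  InWₚ⇒lp≡0 {p} w w∈Wₚ β (β-root , β≥0) β∉Φₚ (_ , wβ≤0) =
    β∉Φₚ ((β-root , ℤP.≤-antisym (subst (_≤ 0ℤ) (InWₚ⇒lookupₚ w w∈Wₚ β) (wβ≤0 p)) (β≥0 p)) , β≥0)

  module _ (diag : ∀ i → A i i ≡ + 2) where

    s-involutive : ∀ i x → s A i (s A i x) ≡ x
    s-involutive i x = lookup-ext λ k → begin
      lookup (s A i (s A i x)) k
        ≡⟨ lookup-s i (s A i x) k ⟩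
      lookup (s A i x) k - pair A i (s A i x) * δ i k
        ≡⟨ cong₂ (λ a b → a - b * δ i k) (lookup-s i x k) pair-sx ⟩
      lookup x k - c * δ i k - (c - c * + 2) * δ i k
        ≡⟨ cancel (lookup x k) c (δ i k) ⟩
      lookup x k ∎
      where
      c = pair A i x
      pair-sx : pair A i (s A i x) ≡ c - c * + 2
      pair-sx = trans (pair-s i i x) (cong (λ a → c - c * a) (diag i))
      cancel : ∀ y c e → y - c * e - (c - c * + 2) * e ≡ y
      cancel = solve-∀

    act-reverse-act : ∀ u x → act A (reverse u) (act A u x) ≡ x
    act-reverse-act []      x = refl
    act-reverse-act (i ∷ u) x = begin
      act A (reverse (i ∷ u)) (s A i (act A u x))
        ≡⟨ cong (λ v → act A v (s A i (act A u x))) (unfold-reverse i u) ⟩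
      act A (reverse u ∷ʳ i) (s A i (act A u x))
        ≡⟨ act-++ (reverse u) (i ∷ []) _ ⟩
      act A (reverse u) (s A i (s A i (act A u x)))
        ≡⟨ cong (act A (reverse u)) (s-involutive i _) ⟩
      act A (reverse u) (act A u x)
        ≡⟨ act-reverse-act u x ⟩
      x ∎

    act-act-reverse : ∀ u x → act A u (act A (reverse u) x) ≡ x
    act-act-reverse u x =
      subst (λ v → act A v (act A (reverse u) x) ≡ x) (reverse-involutive u) (act-reverse-act (reverse u) x)

    act-∷ʳ-α : ∀ u j k → lookup (act A (u ∷ʳ j) (α j)) k ≡ - lookup (act A u (α j)) k
    act-∷ʳ-α u j k = begin
      lookup (act A (u ∷ʳ j) (α j)) k
        ≡⟨ cong (λ v → lookup v k) (act-++ u (j ∷ []) (α j)) ⟩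
      lookup (act A u (s A j (α j))) k
        ≡⟨ act-s u j (α j) k ⟩
      U - pair A j (α j) * U
        ≡⟨ cong (λ a → U - a * U) (trans (pair-α j j) (diag j)) ⟩
      U - + 2 * U
        ≡⟨ negate U ⟩
      - U ∎
      where
      U = lookup (act A u (α j)) k
      negate : ∀ a → a - + 2 * a ≡ - a
      negate = solve-∀

    ∷ʳ-nonneg⇒nonpos : ∀ u j → NonNeg A (act A (u ∷ʳ j) (α j)) → NonPos A (act A u (α j))
    ∷ʳ-nonneg⇒nonpos u j uⱼαⱼ≥0 k = subst (_≤ 0ℤ) (ℤP.neg-involutive _)
      (ℤP.neg-mono-≤ (subst (0ℤ ≤_) (act-∷ʳ-α u j k) (uⱼαⱼ≥0 k)))

    -- s_i only moves the i-th coordinate, so β = c α_i with c ≥ 0; and c = 1 because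
    -- α_j = y⁻¹β = c · y⁻¹α_i has integral coordinates.
    simple-root : ∀ y j i → NonNeg A (act A y (α j)) → NonPos A (s A i (act A y (α j))) →
                  act A y (α j) ≡ α i
    simple-root y j i β≥0 sβ≤0 = lookup-ext λ m → begin
      lookup β m      ≡⟨ β≡δc m ⟩
      δ i m * c       ≡⟨ cong (δ i m *_) c≡1 ⟩
      δ i m * + 1     ≡⟨ ℤP.*-identityʳ (δ i m) ⟩
      δ i m           ≡⟨ sym (lookup-α i m) ⟩
      lookup (α i) m  ∎
      where
      β = act A y (α j)
      c = lookup β i
      β≡δc : ∀ m → lookup β m ≡ δ i m * c
      β≡δc m with i ≟ m
      ... | yes refl = sym (trans (cong (_* c) (δ-diag i)) (ℤP.*-identityˡ c))
      ... | no i≢m   = trans (ℤP.≤-antisym (subst (_≤ 0ℤ) (lookup-s-≢ β i≢m) (sβ≤0 m)) (β≥0 m))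
                             (sym (trans (cong (_* c) (δ-offdiag i≢m)) (ℤP.*-zeroˡ c)))
      M : Fin r → ℤ
      M m = lookup (act A (reverse y) (α m)) j
      c≡1 : c ≡ + 1
      c≡1 = i*j≡1⇒j≡1 (M i) (β≥0 i) (sym (begin
        + 1
          ≡⟨ sym (lookup-α-diag j) ⟩
        lookup (α j) j
          ≡⟨ cong (λ v → lookup v j) (sym (act-reverse-act y (α j))) ⟩
        lookup (act A (reverse y) β) j
          ≡⟨ act-linear (reverse y) β j ⟩
        ∑ (λ m → M m * lookup β m)
          ≡⟨ ∑-cong (λ m → trans (cong (M m *_) (β≡δc m)) (swap (M m) (δ i m) c)) ⟩
        ∑ (λ m → δ i m * (M m * c))
          ≡⟨ ∑-δˡ i (λ m → M m * c) ⟩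
        M i * c ∎))
        where
        swap : ∀ a b c → a * (b * c) ≡ b * (a * c)
        swap = solve-∀

    InWₚ⇒CardOne : ∀ {p} w → InWₚ p w → CardOne A p w
    InWₚ⇒CardOne {p} w w∈Wₚ@(v , _ , v≈w) = β₀ , ((p , sym wβ₀≡αₚ) , β₀∉Φₚ) , unique
      where
      wₚ : ∀ x → lookup (act A w x) p ≡ lookup x p
      wₚ = InWₚ⇒lookupₚ w w∈Wₚ
      w⁻¹ : ∀ γ j → α j ≡ act A w γ → γ ≡ act A (reverse v) (α j)
      w⁻¹ γ j αⱼ≡wγ = begin
        γ                               ≡⟨ sym (act-reverse-act v γ) ⟩
        act A (reverse v) (act A v γ)   ≡⟨ cong (act A (reverse v)) (trans (v≈w γ) (sym αⱼ≡wγ)) ⟩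
        act A (reverse v) (α j)         ∎
      β₀ : Lat r
      β₀ = act A (reverse v) (α p)
      wβ₀≡αₚ : act A w β₀ ≡ α p
      wβ₀≡αₚ = trans (sym (v≈w β₀)) (act-act-reverse v (α p))
      β₀∉Φₚ : ¬ InΦp A p β₀
      β₀∉Φₚ (_ , β₀ₚ≡0) =
        lookup-α-diag≢0 p (trans (cong (λ y → lookup y p) (sym wβ₀≡αₚ)) (trans (wₚ β₀) β₀ₚ≡0))
      unique : ∀ γ → InW⁻¹Δ∖Φp A p w γ → γ ≡ β₀
      unique γ ((j , αⱼ≡wγ) , γ∉Φₚ) with j ≟ p
      ... | yes refl = w⁻¹ γ j αⱼ≡wγ
      ... | no j≢p   = ⊥-elim (γ∉Φₚ ((reverse v , j , sym (w⁻¹ γ j αⱼ≡wγ)) , γₚ≡0))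
        where
        γₚ≡0 : lookup γ p ≡ 0ℤ
        γₚ≡0 = trans (sym (wₚ γ)) (trans (cong (λ y → lookup y p) (sym αⱼ≡wγ)) (lookup-α-offdiag j≢p))

    RHS⇒LHS : ∀ p w → RHS A p w → LHS A p w
    RHS⇒LHS p w (w∈Wp , w-on-Δₚ) = (w∈𝔚ₚ , InWₚ⇒lp≡0 w w∈Wₚ) , InWₚ⇒CardOne w w∈Wₚ
      where
      w∈Wₚ : InWₚ p w
      w∈Wₚ = InWp⇒InWₚ w w∈Wp
      w∈𝔚ₚ : InFrakWp A p w
      w∈𝔚ₚ β β∈Δₚ with w-on-Δₚ β β∈Δₚ
      ... | inj₁ (j , _ , αⱼ≡wβ)        = inj₁ (j , αⱼ≡wβ)
      ... | inj₂ ((wβ-root , _) , wβ≤0) = inj₂ (wβ-root , wβ≤0)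

    module _ (d : Fin r → ℕ) (dsym : ∀ i j → + d i * A i j ≡ + d j * A j i) where

      -- ⟨x, y⟩, since ⟨α_i, α_j⟩ = d i * A i j
      form : Lat r → Lat r → ℤ
      form x y = ∑ (λ i → ∑ (λ j → lookup x i * + d i * A i j * lookup y j))

      form-pairˡ : ∀ x y → form x y ≡ ∑ (λ i → lookup x i * + d i * pair A i y)
      form-pairˡ x y = ∑-cong λ i → begin
        ∑ (λ j → lookup x i * + d i * A i j * lookup y j)
          ≡⟨ ∑-cong (λ j → ℤP.*-assoc (lookup x i * + d i) (A i j) (lookup y j)) ⟩
        ∑ (λ j → lookup x i * + d i * (A i j * lookup y j))
          ≡⟨ sym (*-distribˡ-∑ {r} (lookup x i * + d i) _) ⟩
        lookup x i * + d i * pair A i y ∎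

      term-sym : ∀ x y i j →
                 lookup x i * + d i * A i j * lookup y j ≡ lookup y j * + d j * A j i * lookup x i
      term-sym x y i j = begin
        lookup x i * + d i * A i j * lookup y j
          ≡⟨ regroup (lookup x i) (lookup y j) (+ d i) (A i j) ⟩
        (+ d i * A i j) * (lookup x i * lookup y j)
          ≡⟨ cong (_* (lookup x i * lookup y j)) (dsym i j) ⟩
        (+ d j * A j i) * (lookup x i * lookup y j)
          ≡⟨ regroup′ (lookup x i) (lookup y j) (+ d j) (A j i) ⟩
        lookup y j * + d j * A j i * lookup x i ∎
        where
        regroup : ∀ a b c e → a * c * e * b ≡ (c * e) * (a * b)
        regroup = solve-∀
        regroup′ : ∀ a b c e → (c * e) * (a * b) ≡ b * c * e * a
        regroup′ = solve-∀

      form-sym : ∀ x y → form x y ≡ form y x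
      form-sym x y = trans (∑-comm {r} {r} _) (∑-cong λ j → ∑-cong λ i → term-sym x y i j)

      form-αˡ : ∀ k y → form (α k) y ≡ + d k * pair A k y
      form-αˡ k y = begin
        form (α k) y
          ≡⟨ form-pairˡ (α k) y ⟩
        ∑ (λ i → lookup (α k) i * + d i * pair A i y)
          ≡⟨ ∑-cong (λ i → trans (cong (λ a → a * + d i * pair A i y) (lookup-α k i))
                                 (ℤP.*-assoc (δ k i) _ _)) ⟩
        ∑ (λ i → δ k i * (+ d i * pair A i y))
          ≡⟨ ∑-δˡ k (λ i → + d i * pair A i y) ⟩
        + d k * pair A k y ∎

      form-s : ∀ k x y → form (s A k x) (s A k y) ≡ form x y
      form-s k x y = begin
        form (s A k x) (s A k y)
          ≡⟨ form-sˡ x (s A k y) ⟩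
        form x (s A k y) - a * form (α k) (s A k y)
          ≡⟨ cong₂ (λ t u → t - a * u) (form-sym x (s A k y)) (form-αˡ k (s A k y)) ⟩
        form (s A k y) x - a * (+ d k * pair A k (s A k y))
          ≡⟨ cong₂ (λ t u → t - a * (+ d k * u)) (form-sˡ y x) pair-sy ⟩
        form y x - b * form (α k) x - a * (+ d k * (b - b * + 2))
          ≡⟨ cong₂ (λ t u → t - b * u - a * (+ d k * (b - b * + 2))) (form-sym y x) (form-αˡ k x) ⟩
        form x y - b * (+ d k * a) - a * (+ d k * (b - b * + 2))
          ≡⟨ cancel (form x y) a b (+ d k) ⟩
        form x y ∎
        where
        a = pair A k x
        b = pair A k y
        pair-sy : pair A k (s A k y) ≡ b - b * + 2
        pair-sy = trans (pair-s k k y) (cong (λ t → b - b * t) (diag k))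
        cancel : ∀ f a b c → f - b * (c * a) - a * (c * (b - b * + 2)) ≡ f
        cancel = solve-∀
        form-sˡ : ∀ x y → form (s A k x) y ≡ form x y - pair A k x * form (α k) y
        form-sˡ x y = begin
          form (s A k x) y
            ≡⟨ form-pairˡ (s A k x) y ⟩
          ∑ (λ i → lookup (s A k x) i * + d i * pair A i y)
            ≡⟨ ∑-cong (λ i → cong (λ t → t * + d i * pair A i y) (lookup-s k x i)) ⟩
          ∑ (λ i → (lookup x i - c * δ k i) * + d i * pair A i y)
            ≡⟨ ∑-cong (λ i → expand (lookup x i) c (δ k i) (+ d i) (pair A i y)) ⟩
          ∑ (λ i → lookup x i * + d i * pair A i y - c * (δ k i * (+ d i * pair A i y)))
            ≡⟨ ∑-distrib-- {r} _ _ ⟩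
          ∑ (λ i → lookup x i * + d i * pair A i y) - ∑ (λ i → c * (δ k i * (+ d i * pair A i y)))
            ≡⟨ cong₂ _-_ (sym (form-pairˡ x y)) (sym (*-distribˡ-∑ {r} c _)) ⟩
          form x y - c * ∑ (λ i → δ k i * (+ d i * pair A i y))
            ≡⟨ cong (λ t → form x y - c * t) (trans (∑-δˡ k _) (sym (form-αˡ k y))) ⟩
          form x y - c * form (α k) y ∎
          where
          c = pair A k x
          expand : ∀ z c e g h → (z - c * e) * g * h ≡ z * g * h - c * (e * (g * h))
          expand = solve-∀

      form-act : ∀ u x y → form (act A u x) (act A u y) ≡ form x y
      form-act []      x y = refl
      form-act (i ∷ u) x y = trans (form-s i (act A u x) (act A u y)) (form-act u x y)

      form-root : ∀ u i → form (act A u (α i)) (act A u (α i)) ≡ + d i * + 2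
      form-root u i = begin
        form (act A u (α i)) (act A u (α i))  ≡⟨ form-act u (α i) (α i) ⟩
        form (α i) (α i)                      ≡⟨ form-αˡ i (α i) ⟩
        + d i * pair A i (α i)                ≡⟨ cong (+ d i *_) (trans (pair-α i i) (diag i)) ⟩
        + d i * + 2                           ∎

      infix 4 _∣ᵈ_
      _∣ᵈ_ : ℤ → Lat r → Set
      e ∣ᵈ x = ∀ k → e ∣ + d k * lookup x k

      ∣ᵈ⇒∣-pair : ∀ {e x} j → e ∣ᵈ x → e ∣ + d j * pair A j x
      ∣ᵈ⇒∣-pair {e} {x} j e∣ᵈx = subst (e ∣_) (sym rewritten) (∣-∑ _ (λ l → ∣n⇒∣m*n (A l j) (e∣ᵈx l)))
        where
        rewritten : + d j * pair A j x ≡ ∑ (λ l → A l j * (+ d l * lookup x l))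
        rewritten = trans (*-distribˡ-∑ {r} (+ d j) _) (∑-cong λ l → begin
          + d j * (A j l * lookup x l)    ≡⟨ sym (ℤP.*-assoc (+ d j) (A j l) (lookup x l)) ⟩
          + d j * A j l * lookup x l      ≡⟨ cong (_* lookup x l) (dsym j l) ⟩
          + d l * A l j * lookup x l      ≡⟨ regroup (+ d l) (A l j) (lookup x l) ⟩
          A l j * (+ d l * lookup x l)    ∎)
          where
          regroup : ∀ a b c → a * b * c ≡ b * (a * c)
          regroup = solve-∀

      ∣ᵈ-s : ∀ {e x} j → e ∣ᵈ x → e ∣ᵈ s A j x
      ∣ᵈ-s {e} {x} j e∣ᵈx k with j ≟ k
      ... | no j≢k   = subst (λ t → e ∣ + d k * t) (sym (lookup-s-≢ x j≢k)) (e∣ᵈx k)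
      ... | yes refl = subst (e ∣_) (sym expand) (∣m∣n⇒∣m-n (e∣ᵈx j) (∣ᵈ⇒∣-pair {x = x} j e∣ᵈx))
        where
        expand : + d j * lookup (s A j x) j ≡ + d j * lookup x j - + d j * pair A j x
        expand = begin
          + d j * lookup (s A j x) j
            ≡⟨ cong (+ d j *_) (lookup-s j x j) ⟩
          + d j * (lookup x j - pair A j x * δ j j)
            ≡⟨ cong (λ t → + d j * (lookup x j - pair A j x * t)) (δ-diag j) ⟩
          + d j * (lookup x j - pair A j x * + 1)
            ≡⟨ distribute (+ d j) (lookup x j) (pair A j x) ⟩
          + d j * lookup x j - + d j * pair A j x ∎
          where
          distribute : ∀ a b c → a * (b - c * + 1) ≡ a * b - a * c
          distribute = solve-∀

      ∣ᵈ-α : ∀ i → + d i ∣ᵈ α i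
      ∣ᵈ-α i k with i ≟ k
      ... | yes refl = subst (λ t → + d i ∣ + d i * t) (sym (lookup-α-diag i)) (∣m⇒∣m*n (+ 1) ∣-refl)
      ... | no i≢k   = subst (λ t → + d i ∣ + d k * t) (sym (lookup-α-offdiag i≢k))
                             (∣n⇒∣m*n (+ d k) (divides 0ℤ refl))

      ∣ᵈ-root : ∀ u i → + d i ∣ᵈ act A u (α i)
      ∣ᵈ-root []      i = ∣ᵈ-α i
      ∣ᵈ-root (j ∷ u) i = ∣ᵈ-s j (∣ᵈ-root u i)

      ∣ᵈ⇒2∣form : ∀ {e y} → e ∣ᵈ y → + 2 * e ∣ form y y
      ∣ᵈ⇒2∣form {e} {y} e∣ᵈy = ∣-∑∑-symmetric T T-sym 2e∣Taa e∣Tab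
        where
        T : Fin r → Fin r → ℤ
        T a b = lookup y a * + d a * A a b * lookup y b
        T-sym : ∀ a b → T a b ≡ T b a
        T-sym a b = term-sym y y a b
        2e∣Taa : ∀ a → + 2 * e ∣ T a a
        2e∣Taa a = subst (+ 2 * e ∣_) (sym diagonal) (∣m⇒∣m*n (lookup y a) (*-monoʳ-∣ (+ 2) (e∣ᵈy a)))
          where
          diagonal : T a a ≡ + 2 * (+ d a * lookup y a) * lookup y a
          diagonal = trans (cong (λ t → lookup y a * + d a * t * lookup y a) (diag a))
                           (regroup (lookup y a) (+ d a))
            where
            regroup : ∀ y d → y * d * + 2 * y ≡ + 2 * (d * y) * y
            regroup = solve-∀
        e∣Tab : ∀ a b → e ∣ T a b
        e∣Tab a b = subst (e ∣_) (sym (regroup (lookup y a) (+ d a) (A a b) (lookup y b)))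
                          (∣m⇒∣m*n (A a b * lookup y b) (e∣ᵈy a))
          where
          regroup : ∀ y d a z → y * d * a * z ≡ d * y * (a * z)
          regroup = solve-∀

      form-subˡ : ∀ x p n y → (∀ k → lookup x k ≡ lookup p k - lookup n k) →
                  form x y ≡ form p y - form n y
      form-subˡ x p n y x≡p-n = begin
        form x y
          ≡⟨ ∑-cong (λ i → ∑-cong (λ j → trans (cong (λ t → t * + d i * A i j * lookup y j) (x≡p-n i))
                                                (distrib (lookup p i) (lookup n i) (+ d i) (A i j) (lookup y j)))) ⟩
        ∑ (λ i → ∑ (λ j → term p i j - term n i j))
          ≡⟨ ∑-cong {r} (λ i → ∑-distrib-- {r} (term p i) (term n i)) ⟩
        ∑ (λ i → ∑ (term p i) - ∑ (term n i))
          ≡⟨ ∑-distrib-- {r} _ _ ⟩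
        form p y - form n y ∎
        where
        term : Lat r → Fin r → Fin r → ℤ
        term z i j = lookup z i * + d i * A i j * lookup y j
        distrib : ∀ a b c e f → (a - b) * c * e * f ≡ a * c * e * f - b * c * e * f
        distrib = solve-∀

      form-subʳ : ∀ x y p n → (∀ k → lookup y k ≡ lookup p k - lookup n k) →
                  form x y ≡ form x p - form x n
      form-subʳ x y p n y≡p-n = begin
        form x y             ≡⟨ form-sym x y ⟩
        form y x             ≡⟨ form-subˡ y p n x y≡p-n ⟩
        form p x - form n x  ≡⟨ cong₂ _-_ (form-sym p x) (form-sym n x) ⟩
        form x p - form x n  ∎

      form-⁺ᵛ-⁻ᵛ : ∀ x → form x x + (form (x ⁺ᵛ) (x ⁻ᵛ) + form (x ⁺ᵛ) (x ⁻ᵛ)) ≡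
                         form (x ⁺ᵛ) (x ⁺ᵛ) + form (x ⁻ᵛ) (x ⁻ᵛ)
      form-⁺ᵛ-⁻ᵛ x = begin
        form x x + (C + C)         ≡⟨ cong (_+ (C + C)) form-x ⟩
        P - C - (C - N) + (C + C)  ≡⟨ cancel P N C ⟩
        P + N                      ∎
        where
        P N C : ℤ
        P = form (x ⁺ᵛ) (x ⁺ᵛ)
        N = form (x ⁻ᵛ) (x ⁻ᵛ)
        C = form (x ⁺ᵛ) (x ⁻ᵛ)
        cancel : ∀ p n c → p - c - (c - n) + (c + c) ≡ p + n
        cancel = solve-∀
        form-x : form x x ≡ P - C - (C - N)
        form-x = begin
          form x x
            ≡⟨ form-subˡ x (x ⁺ᵛ) (x ⁻ᵛ) x (lookup-⁺ᵛ-⁻ᵛ x) ⟩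
          form (x ⁺ᵛ) x - form (x ⁻ᵛ) x
            ≡⟨ cong₂ _-_ (form-subʳ (x ⁺ᵛ) x (x ⁺ᵛ) (x ⁻ᵛ) (lookup-⁺ᵛ-⁻ᵛ x))
                         (form-subʳ (x ⁻ᵛ) x (x ⁺ᵛ) (x ⁻ᵛ) (lookup-⁺ᵛ-⁻ᵛ x)) ⟩
          P - C - (form (x ⁻ᵛ) (x ⁺ᵛ) - N)
            ≡⟨ cong (λ t → P - C - (t - N)) (form-sym (x ⁻ᵛ) (x ⁺ᵛ)) ⟩
          P - C - (C - N) ∎

      ∣ᵈ-⁺ᵛ : ∀ {e} x → e ∣ᵈ x → e ∣ᵈ x ⁺ᵛ
      ∣ᵈ-⁺ᵛ {e} x e∣ᵈx k =
        subst (λ t → e ∣ + d k * t) (sym (lookup-map k _⁺ x)) (∣*⇒∣*⁺ (+ d k) (lookup x k) (e∣ᵈx k))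

      ∣ᵈ-⁻ᵛ : ∀ {e} x → e ∣ᵈ x → e ∣ᵈ x ⁻ᵛ
      ∣ᵈ-⁻ᵛ {e} x e∣ᵈx k =
        subst (λ t → e ∣ + d k * t) (sym (lookup-map k _⁻ x)) (∣*⇒∣*⁻ (+ d k) (lookup x k) (e∣ᵈx k))

      module _ (dpos : ∀ i → 0 ℕ.< d i) where

        pair-act : ∀ u j i → act A u (α j) ≡ α i → ∀ x → pair A i (act A u x) ≡ pair A j x
        pair-act u j i uαj≡αi x = ℤP.*-cancelˡ-≡ (+ d i) _ _ {{ℕ.>-nonZero (dpos i)}} (begin
          + d i * pair A i (act A u x)      ≡⟨ sym (form-αˡ i (act A u x)) ⟩
          form (α i) (act A u x)            ≡⟨ cong (λ v → form v (act A u x)) (sym uαj≡αi) ⟩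
          form (act A u (α j)) (act A u x)  ≡⟨ form-act u (α j) x ⟩
          form (α j) x                      ≡⟨ form-αˡ j x ⟩
          + d j * pair A j x                ≡⟨ cong (_* pair A j x) (sym dᵢ≡dⱼ) ⟩
          + d i * pair A j x                ∎)
          where
          dᵢ≡dⱼ : + d i ≡ + d j
          dᵢ≡dⱼ = ℤP.*-cancelʳ-≡ (+ d i) (+ d j) (+ 2)
                    (trans (sym (form-root [] i))
                           (trans (cong (λ v → form v v) (sym uαj≡αi)) (form-root u j)))

        act-conj : ∀ u j i → act A u (α j) ≡ α i → ∀ x → s A i (act A u x) ≡ act A u (s A j x)
        act-conj u j i uαj≡αi x = lookup-ext coordinate
          where
          coordinate : ∀ k → lookup (s A i (act A u x)) k ≡ lookup (act A u (s A j x)) k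
          coordinate k = begin
            lookup (s A i (act A u x)) k
              ≡⟨ lookup-s i (act A u x) k ⟩
            lookup (act A u x) k - pair A i (act A u x) * δ i k
              ≡⟨ cong₂ (λ a b → lookup (act A u x) k - a * b) (pair-act u j i uαj≡αi x) δᵢₖ≡uαⱼ ⟩
            lookup (act A u x) k - pair A j x * lookup (act A u (α j)) k
              ≡⟨ sym (act-s u j x k) ⟩
            lookup (act A u (s A j x)) k ∎
            where
            δᵢₖ≡uαⱼ : δ i k ≡ lookup (act A u (α j)) k
            δᵢₖ≡uαⱼ = trans (sym (lookup-α i k)) (cong (λ v → lookup v k) (sym uαj≡αi))

        module _ (offd : ∀ i j → i ≢ j → A i j ≤ 0ℤ)
                 (pd : ∀ x → x ≢ replicate r 0ℤ → 0ℤ < form x x) where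

          2e≤form : ∀ {e y} → 0ℤ < e → e ∣ᵈ y → y ≢ replicate r 0ℤ → + 2 * e ≤ form y y
          2e≤form {y = y} 0<e e∣ᵈy y≢0 =
            ∣⇒≤ (0≤i⇒0≤j⇒0≤i*j {+ 2} (+≤+ ℕ.z≤n) (ℤP.<⇒≤ 0<e)) (pd y y≢0) (∣ᵈ⇒2∣form {y = y} e∣ᵈy)

          form-⁺ᵛ-⁻ᵛ-nonpos : ∀ x → form (x ⁺ᵛ) (x ⁻ᵛ) ≤ 0ℤ
          form-⁺ᵛ-⁻ᵛ-nonpos x = ∑-nonpos _ λ a → ∑-nonpos _ λ b → term≤0 a b
            where
            term≤0 : ∀ a b → lookup (x ⁺ᵛ) a * + d a * A a b * lookup (x ⁻ᵛ) b ≤ 0ℤ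
            term≤0 a b rewrite lookup-map a _⁺ x | lookup-map b _⁻ x with a ≟ b
            ... | yes refl = ℤP.≤-reflexive (begin
              lookup x a ⁺ * + d a * A a a * lookup x a ⁻    ≡⟨ regroup (lookup x a ⁺) (lookup x a ⁻) (+ d a) (A a a) ⟩
              lookup x a ⁺ * lookup x a ⁻ * (+ d a * A a a)  ≡⟨ cong (_* (+ d a * A a a)) (⁺*⁻ (lookup x a)) ⟩
              0ℤ * (+ d a * A a a)                           ≡⟨ ℤP.*-zeroˡ (+ d a * A a a) ⟩
              0ℤ                                             ∎)
              where
              regroup : ∀ p n c e → p * c * e * n ≡ p * n * (c * e)
              regroup = solve-∀
            ... | no a≢b = subst (_≤ 0ℤ) (sym (regroup (lookup x a ⁺) (lookup x b ⁻) (+ d a) (A a b)))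
                             (0≤i⇒j≤0⇒i*j≤0 0≤x⁺dx⁻ (offd a b a≢b))
              where
              regroup : ∀ p n c e → p * c * e * n ≡ p * c * n * e
              regroup = solve-∀
              0≤x⁺dx⁻ : 0ℤ ≤ lookup x a ⁺ * + d a * lookup x b ⁻
              0≤x⁺dx⁻ = 0≤i⇒0≤j⇒0≤i*j (0≤i⇒0≤j⇒0≤i*j (⁺-nonneg (lookup x a)) (+≤+ ℕ.z≤n)) (⁻-nonneg (lookup x b))

          mixed-sign-impossible : ∀ {e} x → 0ℤ < e → e ∣ᵈ x → form x x ≡ e * + 2 →
                                  x ⁺ᵛ ≢ replicate r 0ℤ → x ⁻ᵛ ≢ replicate r 0ℤ → ⊥
          mixed-sign-impossible {e} x 0<e e∣ᵈx form≡ x⁺≢0 x⁻≢0 =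
            ℤP.<⇒≱ 0<2e (i+j≤i⇒j≤0 (ℤP.≤-trans 4e≤P+N P+N≤2e))
            where
            0<2e : 0ℤ < + 2 * e
            0<2e = ℤP.*-monoˡ-<-pos (+ 2) 0<e
            4e≤P+N : + 2 * e + + 2 * e ≤ form (x ⁺ᵛ) (x ⁺ᵛ) + form (x ⁻ᵛ) (x ⁻ᵛ)
            4e≤P+N = ℤP.+-mono-≤ (2e≤form 0<e (∣ᵈ-⁺ᵛ x e∣ᵈx) x⁺≢0) (2e≤form 0<e (∣ᵈ-⁻ᵛ x e∣ᵈx) x⁻≢0)
            P+N≤2e : form (x ⁺ᵛ) (x ⁺ᵛ) + form (x ⁻ᵛ) (x ⁻ᵛ) ≤ + 2 * e
            P+N≤2e = subst₂ _≤_ (form-⁺ᵛ-⁻ᵛ x) (trans (ℤP.+-identityʳ _) (trans form≡ (ℤP.*-comm e (+ 2))))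
                       (ℤP.+-monoʳ-≤ (form x x) (ℤP.+-mono-≤ (form-⁺ᵛ-⁻ᵛ-nonpos x) (form-⁺ᵛ-⁻ᵛ-nonpos x)))

          nonneg⊎nonpos : ∀ {e} x → 0ℤ < e → e ∣ᵈ x → form x x ≡ e * + 2 → NonNeg A x ⊎ NonPos A x
          nonneg⊎nonpos x 0<e e∣ᵈx form≡ with ≡-dec ℤ._≟_ (x ⁻ᵛ) (replicate r 0ℤ)
                                           | ≡-dec ℤ._≟_ (x ⁺ᵛ) (replicate r 0ℤ)
          ... | yes x⁻≡0 | _        = inj₁ λ k → ⁻≡0⇒0≤ (map≡replicate⇒lookup x x⁻≡0 k)
          ... | no _     | yes x⁺≡0 = inj₂ λ k → ⁺≡0⇒≤0 (map≡replicate⇒lookup x x⁺≡0 k)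
          ... | no x⁻≢0  | no x⁺≢0  = ⊥-elim (mixed-sign-impossible x 0<e e∣ᵈx form≡ x⁺≢0 x⁻≢0)

          root-dichotomy : ∀ u i → NonNeg A (act A u (α i)) ⊎ NonPos A (act A u (α i))
          root-dichotomy u i = nonneg⊎nonpos (act A u (α i)) (+<+ (dpos i)) (∣ᵈ-root u i) (form-root u i)

          exchange : ∀ y j → NonPos A (act A y (α j)) →
                     ∃[ y′ ] suc (length y′) ≡ length y × _≈W_ A y′ (y ∷ʳ j)
          exchange []      j αⱼ≤0 = ⊥-elim (lookup-α-diag≢0 j (ℤP.≤-antisym (αⱼ≤0 j) (α-nonneg j j)))
          exchange (i ∷ y) j iyαⱼ≤0 with root-dichotomy y j
          ... | inj₂ yαⱼ≤0 with exchange y j yαⱼ≤0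
          ...   | y′ , |y′|+1≡|y| , y′≈yj = i ∷ y′ , cong suc |y′|+1≡|y| , λ x → cong (s A i) (y′≈yj x)
          exchange (i ∷ y) j iyαⱼ≤0 | inj₁ yαⱼ≥0 = y , refl , λ x → sym (begin
            s A i (act A (y ∷ʳ j) x)
              ≡⟨ cong (s A i) (act-++ y (j ∷ []) x) ⟩
            s A i (act A y (s A j x))
              ≡⟨ act-conj y j i (simple-root y j i yαⱼ≥0 iyαⱼ≤0) (s A j x) ⟩
            act A y (s A j (s A j x))
              ≡⟨ cong (act A y) (s-involutive j x) ⟩
            act A y x ∎)

          module _ (p : Fin r) where

            s-preserves-Φ⁺∖Φₚ : ∀ {k β} → k ≢ p → InΦ⁺ A β → ¬ InΦp⁺ A p β →
                                InΦ⁺ A (s A k β) × ¬ InΦp⁺ A p (s A k β)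
            s-preserves-Φ⁺∖Φₚ {k} k≢p (β-root@(u , i , refl) , β≥0) β∉Φₚ = (sβ-root , sβ≥0) , sβ∉Φₚ
              where
              β = act A u (α i)
              sβ-root : IsRoot A (s A k β)
              sβ-root = k ∷ u , i , refl
              βₚ≢0 : lookup β p ≢ 0ℤ
              βₚ≢0 βₚ≡0 = β∉Φₚ ((β-root , βₚ≡0) , β≥0)
              sβₚ≡βₚ : lookup (s A k β) p ≡ lookup β p
              sβₚ≡βₚ = lookup-s-≢ β k≢p
              sβ≥0 : NonNeg A (s A k β)
              sβ≥0 = [ id , (λ sβ≤0 → ⊥-elim (βₚ≢0 (ℤP.≤-antisym (subst (_≤ 0ℤ) sβₚ≡βₚ (sβ≤0 p)) (β≥0 p)))) ]′
                       (root-dichotomy (k ∷ u) i)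
              sβ∉Φₚ : ¬ InΦp⁺ A p (s A k β)
              sβ∉Φₚ ((_ , sβₚ≡0) , _) = βₚ≢0 (trans (sym sβₚ≡βₚ) sβₚ≡0)

            lp≡0-∷ʳ : ∀ w {k} → k ≢ p → lp≡0 A p w → lp≡0 A p (w ∷ʳ k)
            lp≡0-∷ʳ w {k} k≢p lp-w β β⁺ β∉Φₚ with s-preserves-Φ⁺∖Φₚ k≢p β⁺ β∉Φₚ
            ... | sβ⁺ , sβ∉Φₚ = lp-w (s A k β) sβ⁺ sβ∉Φₚ ∘ subst (InΦ⁻ A) (act-++ w (k ∷ []) β)

            lp≡0⇒InWₚ : ∀ w → Acc ℕ._<_ (length w) → lp≡0 A p w → InWₚ p w
            lp≡0⇒InWₚ w (acc rec) lp-w with initLast w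
            ... | [] = [] , [] , λ _ → refl
            ... | y ∷ʳ′ j with root-dichotomy (y ∷ʳ j) j
            ...   | inj₂ wαⱼ≤0 = InWₚ-∷ʳ y j j≢p (lp≡0⇒InWₚ y (rec |y|<|w|) lp-y)
              where
              j≢p = lp≡0⇒≢p (y ∷ʳ j) j lp-w wαⱼ≤0
              |y|<|w| : length y ℕ.< length (y ∷ʳ j)
              |y|<|w| = subst (length y ℕ.<_) (sym (length-∷ʳ y j)) ℕP.≤-refl
              y≈wj : _≈W_ A y ((y ∷ʳ j) ∷ʳ j)
              y≈wj β = sym (begin
                act A ((y ∷ʳ j) ∷ʳ j) β   ≡⟨ act-++ (y ∷ʳ j) (j ∷ []) β ⟩
                act A (y ∷ʳ j) (s A j β)  ≡⟨ act-++ y (j ∷ []) (s A j β) ⟩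
                act A y (s A j (s A j β)) ≡⟨ cong (act A y) (s-involutive j β) ⟩
                act A y β                 ∎)
              lp-y : lp≡0 A p y
              lp-y = lp≡0-resp-≈W y ((y ∷ʳ j) ∷ʳ j) y≈wj (lp≡0-∷ʳ (y ∷ʳ j) j≢p lp-w)
            ...   | inj₁ wαⱼ≥0 with exchange y j (∷ʳ-nonneg⇒nonpos y j wαⱼ≥0)
            ...     | y′ , |y′|+1≡|y| , y′≈w =
              InWₚ-resp-≈W y′ (y ∷ʳ j) y′≈w
                (lp≡0⇒InWₚ y′ (rec |y′|<|w|) (lp≡0-resp-≈W y′ (y ∷ʳ j) y′≈w lp-w))
              where
              |y′|<|w| : length y′ ℕ.< length (y ∷ʳ j)
              |y′|<|w| = subst (length y′ ℕ.<_) (sym (length-∷ʳ y j))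
                               (ℕP.m≤n⇒m≤1+n (ℕP.≤-reflexive |y′|+1≡|y|))

            LHS⇒RHS : ∀ w → LHS A p w → RHS A p w
            LHS⇒RHS w ((w∈𝔚ₚ , lp-w) , _) = InWₚ⇒InWp w w∈Wₚ , w-on-Δₚ
              where
              w∈Wₚ : InWₚ p w
              w∈Wₚ = lp≡0⇒InWₚ w (<-wellFounded (length w)) lp-w
              wαᵢₚ≡0 : ∀ {i} → i ≢ p → lookup (act A w (α i)) p ≡ 0ℤ
              wαᵢₚ≡0 {i} i≢p = trans (InWₚ⇒lookupₚ w w∈Wₚ (α i)) (lookup-α-offdiag i≢p)
              w-on-Δₚ : ∀ β → InΔp A p β → InΔp A p (act A w β) ⊎ InΦp⁻ A p (act A w β)
              w-on-Δₚ β (i , i≢p , refl) with w∈𝔚ₚ (α i) (i , i≢p , refl)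
              ... | inj₁ (j , αⱼ≡wαᵢ)         = inj₁ (j , j≢p , αⱼ≡wαᵢ)
                where
                j≢p : j ≢ p
                j≢p refl = lookup-α-diag≢0 j (trans (cong (λ y → lookup y j) αⱼ≡wαᵢ) (wαᵢₚ≡0 i≢p))
              ... | inj₂ (wαᵢ-root , wαᵢ≤0) = inj₂ ((wαᵢ-root , wαᵢₚ≡0 i≢p) , wαᵢ≤0)

lemma10p2 : (r : ℕ) (A : Matrix r) → IsIrredFiniteCartan A →
    (p : Fin r) (w : Word A) →
    (LHS A p w → RHS A p w) × (RHS A p w → LHS A p w)
lemma10p2 r A ((diag , offd) , (d , dpos , dsym , pd) , _) p w =
  LHS⇒RHS A diag d dsym dpos offd pd p w , RHS⇒LHS A diag p w
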